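{- Let $\lambda$ be a nonzero real number. For integers $n\ge 0$ let $(x)_{0,\lambda}=1$ and $(x)_{n,\lambda}=x(x-\lambda)\cdots(x-(n-1)\lambda)$ for $n\ge1$. Define the degenerate Eulerian polynomials $A_{n,\lambda}(x)$ by $\sum_{j=0}^{\infty}(j+1)_{n,\lambda}x^{j}=\frac{A_{n,\lambda}(x)}{(1-x)^{n+1}}$ for $|x|<1$, and the degenerate Eulerian numbers $A_\lambda(n,k)$ by $A_{n,\lambda}(x)=\sum_{k=0}^{n}A_{\lambda}(n,k)x^{k}$. Then for all integers $n,k\ge0$, \[\sum_{i=0}^{k}\binom{n+1}{i}(-1)^{i}(k-i+1)_{n,\lambda}=\begin{cases}A_{\lambda}(n,k), & 0\le k\le n,\\ 0, & k>n.\end{cases}\]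
   Context: $A_{n,\lambda}(x)$ is a polynomial of degree at most $n$ in $x$. -}

module Defs where

open import Level using (Level)
open import Data.Nat using (ℕ; zero; suc; _∸_)
open import Algebra.Bundles using (CommutativeRing)

-- All definitions are parametrised by a commutative ring R
-- (playing the role of ℝ).
module _ {c ℓ : Level} (R : CommutativeRing c ℓ) where
  open CommutativeRing R

  ι : ℕ → Carrier
  ι zero    = 0#
  ι (suc n) = 1# + ι n

  sgn : ℕ → Carrier
  sgn zero    = 1#
  sgn (suc i) = - sgn i

  dfall : (lam x : Carrier) → ℕ → Carrier
  dfall lam x zero    = 1#
  dfall lam x (suc n) = dfall lam x n * (x - ι n * lam)

  sumBelow : ℕ → (ℕ → Carrier) → Carrier
  sumBelow zero    f = 0#
  sumBelow (suc m) f = sumBelow m f + f m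

  Series : Set c
  Series = ℕ → Carrier

  _⊛_ : Series → Series → Series
  (f ⊛ g) k = sumBelow (suc k) (λ i → f i * g (k ∸ i))

  oneS : Series
  oneS zero    = 1#
  oneS (suc _) = 0#

  oneMinusX : Series
  oneMinusX zero          = 1#
  oneMinusX (suc zero)    = - 1#
  oneMinusX (suc (suc _)) = 0#

  powS : Series → ℕ → Series
  powS s zero    = oneS
  powS s (suc n) = s ⊛ powS s n

  eulerSeries : (lam : Carrier) → ℕ → Series
  eulerSeries lam n j = dfall lam (ι (suc j)) n

  -- A_{n,λ}(x) = (1-x)^{n+1} Σ_{j≥0} (j+1)_{n,λ} x^j ;
  -- degenerate Eulerian number A_λ(n,k) = coefficient of x^k in A_{n,λ}(x)
  eulerA : (lam : Carrier) → ℕ → ℕ → Carrier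
  eulerA lam n k = (powS oneMinusX (suc n) ⊛ eulerSeries lam n) k

{-# OPTIONS --safe #-}

-- Since (1 - x)^m has coefficients (-1)^i C(m,i), the left-hand side is the k-th coefficient of
-- (1 - x)^(n+1) Σ_j (j+1)_{n,λ} x^j, which is A_λ(n,k) by definition. Multiplying a series by 1 - x
-- takes the backward difference of its coefficients, so this coefficient is the (n+1)-st difference
-- of j ↦ (j+1)_{n,λ} at k; for k > n it is a forward difference of order n + 1 of a polynomial of
-- degree n in j, hence 0.
module Submission where

open import Defs
open import Level using (Level)
open import Data.Nat as ℕ using (ℕ; zero; suc; _∸_; _≤_; _<_)
import Data.Nat.Properties as ℕ
open import Data.Nat.Combinatorics using (_C_; nCk+nC[k+1]≡[n+1]C[k+1])
open import Data.Product using (_×_; _,_)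
open import Relation.Nullary using (¬_)
import Relation.Binary.PropositionalEquality as ≡
open import Algebra.Bundles using (CommutativeRing)
import Algebra.Properties.Ring as RingProperties
import Algebra.Properties.AbelianGroup as AbelianGroupProperties
import Algebra.Properties.CommutativeSemigroup as CommutativeSemigroupProperties
import Relation.Binary.Reasoning.Setoid as SetoidReasoning

module _ {c ℓ : Level} (R : CommutativeRing c ℓ) where
  open CommutativeRing R hiding (zero)
  open RingProperties ring using (-‿distribʳ-*; -‿+-comm; x[y-z]≈xy-xz; [y-z]x≈yx-zx)
  open AbelianGroupProperties +-abelianGroup using (\\-leftDividesʳ; //-rightDividesʳ)
  open CommutativeSemigroupProperties +-commutativeSemigroup using (interchange)
  open SetoidReasoning setoid

  [a-b]+[c-d]≈[a+c]-[b+d] : ∀ a b c d → (a - b) + (c - d) ≈ (a + c) - (b + d)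
  [a-b]+[c-d]≈[a+c]-[b+d] a b c d = trans (interchange a (- b) c (- d)) (+-congˡ (-‿+-comm b d))

  [a-b]+[b-c]≈a-c : ∀ a b c → (a - b) + (b - c) ≈ a - c
  [a-b]+[b-c]≈a-c a b c = trans (+-assoc a (- b) (b - c)) (+-congˡ (\\-leftDividesʳ b (- c)))

  ι-homo-+ : ∀ m n → ι R (m ℕ.+ n) ≈ ι R m + ι R n
  ι-homo-+ zero    n = sym (+-identityˡ (ι R n))
  ι-homo-+ (suc m) n = trans (+-congˡ (ι-homo-+ m n)) (sym (+-assoc 1# (ι R m) (ι R n)))

  sumBelow-cong : ∀ m {f g : ℕ → Carrier} → (∀ i → f i ≈ g i) → sumBelow R m f ≈ sumBelow R m g
  sumBelow-cong zero    f≈g = refl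
  sumBelow-cong (suc m) f≈g = +-cong (sumBelow-cong m f≈g) (f≈g m)

  sumBelow-zero : ∀ m {f : ℕ → Carrier} → (∀ i → f i ≈ 0#) → sumBelow R m f ≈ 0#
  sumBelow-zero zero    f≈0 = refl
  sumBelow-zero (suc m) f≈0 = trans (+-cong (sumBelow-zero m f≈0) (f≈0 m)) (+-identityʳ 0#)

  sumBelow-head : ∀ m (f : ℕ → Carrier) → sumBelow R (suc m) f ≈ f 0 + sumBelow R m (λ i → f (suc i))
  sumBelow-head zero    f = +-comm 0# (f 0)
  sumBelow-head (suc m) f = trans (+-congʳ (sumBelow-head m f)) (+-assoc (f 0) _ _)

  sumBelow-sub : ∀ m (f g : ℕ → Carrier) →
                 sumBelow R m (λ i → f i - g i) ≈ sumBelow R m f - sumBelow R m g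
  sumBelow-sub zero    f g = sym (-‿inverseʳ 0#)
  sumBelow-sub (suc m) f g = trans (+-congʳ (sumBelow-sub m f g)) ([a-b]+[c-d]≈[a+c]-[b+d] _ _ _ _)

  infixl 7 _⋆_

  _⋆_ : Series R → Series R → Series R
  _⋆_ = _⊛_ R

  ⋆-congˡ : ∀ {f g : Series R} (s : Series R) → (∀ i → f i ≈ g i) → ∀ k → (f ⋆ s) k ≈ (g ⋆ s) k
  ⋆-congˡ s f≈g k = sumBelow-cong (suc k) (λ i → *-congʳ (f≈g i))

  ⋆-identityˡ : ∀ (s : Series R) k → (oneS R ⋆ s) k ≈ s k
  ⋆-identityˡ s k = begin
    (oneS R ⋆ s) k                                      ≈⟨ sumBelow-head k _ ⟩
    1# * s k + sumBelow R k (λ i → 0# * s (k ∸ suc i))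
      ≈⟨ +-cong (*-identityˡ (s k)) (sumBelow-zero k (λ i → zeroˡ _)) ⟩
    s k + 0#                                            ≈⟨ +-identityʳ (s k) ⟩
    s k                                                 ∎

  ∇ : Series R → Series R
  ∇ s zero    = s zero
  ∇ s (suc k) = s (suc k) - s k

  ∇-cong : ∀ {f g : Series R} → (∀ i → f i ≈ g i) → ∀ k → ∇ f k ≈ ∇ g k
  ∇-cong f≈g zero    = f≈g zero
  ∇-cong f≈g (suc k) = +-cong (f≈g (suc k)) (-‿cong (f≈g k))

  ∇-⋆ : ∀ (f s : Series R) k → (∇ f ⋆ s) k ≈ ∇ (f ⋆ s) k
  ∇-⋆ f s zero    = refl
  ∇-⋆ f s (suc k) = begin
    (∇ f ⋆ s) (suc k)                                      ≈⟨ sumBelow-head (suc k) _ ⟩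
    f 0 * s (suc k) + sumBelow R (suc k) (λ i → (f (suc i) - f i) * s (k ∸ i))
      ≈⟨ +-congˡ (sumBelow-cong (suc k) (λ i → [y-z]x≈yx-zx (s (k ∸ i)) (f (suc i)) (f i))) ⟩
    f 0 * s (suc k) + sumBelow R (suc k) (λ i → f (suc i) * s (k ∸ i) - f i * s (k ∸ i))
      ≈⟨ +-congˡ (sumBelow-sub (suc k) _ _) ⟩
    f 0 * s (suc k) + (sumBelow R (suc k) (λ i → f (suc i) * s (k ∸ i)) - (f ⋆ s) k)
      ≈⟨ +-assoc _ _ _ ⟨
    (f 0 * s (suc k) + sumBelow R (suc k) (λ i → f (suc i) * s (k ∸ i))) - (f ⋆ s) k
      ≈⟨ +-congʳ (sumBelow-head (suc k) _) ⟨
    (f ⋆ s) (suc k) - (f ⋆ s) k                            ∎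

  oneMinusX≈∇oneS : ∀ i → oneMinusX R i ≈ ∇ (oneS R) i
  oneMinusX≈∇oneS zero          = refl
  oneMinusX≈∇oneS (suc zero)    = sym (+-identityˡ (- 1#))
  oneMinusX≈∇oneS (suc (suc i)) = sym (-‿inverseʳ 0#)

  oneMinusX-⋆ : ∀ (s : Series R) k → (oneMinusX R ⋆ s) k ≈ ∇ s k
  oneMinusX-⋆ s k = begin
    (oneMinusX R ⋆ s) k  ≈⟨ ⋆-congˡ s oneMinusX≈∇oneS k ⟩
    (∇ (oneS R) ⋆ s) k   ≈⟨ ∇-⋆ (oneS R) s k ⟩
    ∇ (oneS R ⋆ s) k     ≈⟨ ∇-cong (⋆-identityˡ s) k ⟩
    ∇ s k                ∎

  ∇ⁿ : ℕ → Series R → Series R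
  ∇ⁿ zero    s = s
  ∇ⁿ (suc m) s = ∇ (∇ⁿ m s)

  powS-oneMinusX-⋆ : ∀ m (s : Series R) k → (powS R (oneMinusX R) m ⋆ s) k ≈ ∇ⁿ m s k
  powS-oneMinusX-⋆ zero    s k = ⋆-identityˡ s k
  powS-oneMinusX-⋆ (suc m) s k = begin
    ((oneMinusX R ⋆ P) ⋆ s) k  ≈⟨ ⋆-congˡ s (oneMinusX-⋆ P) k ⟩
    (∇ P ⋆ s) k                ≈⟨ ∇-⋆ P s k ⟩
    ∇ (P ⋆ s) k                ≈⟨ ∇-cong (powS-oneMinusX-⋆ m s) k ⟩
    ∇ (∇ⁿ m s) k               ∎
    where
    P : Series R
    P = powS R (oneMinusX R) m

  signedBinomial : ℕ → Series R
  signedBinomial m i = ι R (m C i) * sgn R i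

  signedBinomial-suc : ∀ m i → signedBinomial (suc m) i ≈ ∇ (signedBinomial m) i
  signedBinomial-suc m zero    = refl
  signedBinomial-suc m (suc i) = begin
    ι R (suc m C suc i) * - sgn R i
      ≈⟨ *-congʳ (reflexive (≡.cong (ι R) (≡.sym (nCk+nC[k+1]≡[n+1]C[k+1] m i)))) ⟩
    ι R (m C i ℕ.+ m C suc i) * - sgn R i
      ≈⟨ *-congʳ (trans (ι-homo-+ (m C i) (m C suc i)) (+-comm _ _)) ⟩
    (ι R (m C suc i) + ι R (m C i)) * - sgn R i
      ≈⟨ distribʳ (- sgn R i) _ _ ⟩
    ι R (m C suc i) * - sgn R i + ι R (m C i) * - sgn R i
      ≈⟨ +-congˡ (-‿distribʳ-* _ _) ⟨
    ι R (m C suc i) * - sgn R i - ι R (m C i) * sgn R i    ∎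

  powS-oneMinusX : ∀ m i → powS R (oneMinusX R) m i ≈ signedBinomial m i
  powS-oneMinusX zero    zero    = sym (trans (*-identityʳ _) (+-identityʳ 1#))
  powS-oneMinusX zero    (suc i) = sym (zeroˡ _)
  powS-oneMinusX (suc m) i = begin
    (oneMinusX R ⋆ powS R (oneMinusX R) m) i  ≈⟨ oneMinusX-⋆ _ i ⟩
    ∇ (powS R (oneMinusX R) m) i              ≈⟨ ∇-cong (powS-oneMinusX m) i ⟩
    ∇ (signedBinomial m) i                    ≈⟨ signedBinomial-suc m i ⟨
    signedBinomial (suc m) i                  ∎

  Δ : (ℕ → Carrier) → ℕ → Carrier
  Δ f j = f (suc j) - f j

  Δ-cong : ∀ {f g : ℕ → Carrier} → (∀ j → f j ≈ g j) → ∀ j → Δ f j ≈ Δ g j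
  Δ-cong f≈g j = +-cong (f≈g (suc j)) (-‿cong (f≈g j))

  Δ-+ : ∀ (f g : ℕ → Carrier) j → Δ (λ i → f i + g i) j ≈ Δ f j + Δ g j
  Δ-+ f g j = sym ([a-b]+[c-d]≈[a+c]-[b+d] (f (suc j)) (f j) (g (suc j)) (g j))

  Δ-* : ∀ (f g : ℕ → Carrier) j → Δ (λ i → f i * g i) j ≈ Δ f j * g (suc j) + f j * Δ g j
  Δ-* f g j = sym (begin
    Δ f j * g (suc j) + f j * Δ g j
      ≈⟨ +-cong ([y-z]x≈yx-zx (g (suc j)) (f (suc j)) (f j)) (x[y-z]≈xy-xz (f j) (g (suc j)) (g j)) ⟩
    (f (suc j) * g (suc j) - f j * g (suc j)) + (f j * g (suc j) - f j * g j)
      ≈⟨ [a-b]+[b-c]≈a-c _ _ _ ⟩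
    f (suc j) * g (suc j) - f j * g j  ∎)

  Δ[ι∘suc-a]≈1 : ∀ a j → Δ (λ i → ι R (suc i) - a) j ≈ 1#
  Δ[ι∘suc-a]≈1 a j = begin
    (1# + ι R (suc j) - a) - (ι R (suc j) - a)     ≈⟨ [a-b]+[c-d]≈[a+c]-[b+d] _ _ _ _ ⟨
    (1# + ι R (suc j) - ι R (suc j)) + (- a - - a) ≈⟨ +-cong (//-rightDividesʳ (ι R (suc j)) 1#) (-‿inverseʳ (- a)) ⟩
    1# + 0#                                        ≈⟨ +-identityʳ 1# ⟩
    1#                                             ∎

  Δⁿ : ℕ → (ℕ → Carrier) → ℕ → Carrier
  Δⁿ zero    f = f
  Δⁿ (suc m) f = Δ (Δⁿ m f)

  Δⁿ-Δ : ∀ m (f : ℕ → Carrier) j → Δⁿ m (Δ f) j ≈ Δⁿ (suc m) f j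
  Δⁿ-Δ zero    f j = refl
  Δⁿ-Δ (suc m) f j = Δ-cong (Δⁿ-Δ m f) j

  ∇ⁿ-Δⁿ : ∀ m (s : ℕ → Carrier) j → ∇ⁿ m s (j ℕ.+ m) ≈ Δⁿ m s j
  ∇ⁿ-Δⁿ zero    s j rewrite ℕ.+-identityʳ j = refl
  ∇ⁿ-Δⁿ (suc m) s j rewrite ℕ.+-suc j m = Δ-cong (∇ⁿ-Δⁿ m s) j

  DegreeAtMost : ℕ → (ℕ → Carrier) → Set ℓ
  DegreeAtMost zero    f = ∀ j → Δ f j ≈ 0#
  DegreeAtMost (suc d) f = DegreeAtMost d (Δ f)

  DegreeAtMost-cong : ∀ d {f g : ℕ → Carrier} → (∀ j → f j ≈ g j) → DegreeAtMost d f → DegreeAtMost d g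
  DegreeAtMost-cong zero    f≈g f≤0 j = trans (sym (Δ-cong f≈g j)) (f≤0 j)
  DegreeAtMost-cong (suc d) f≈g f≤d   = DegreeAtMost-cong d (Δ-cong f≈g) f≤d

  DegreeAtMost-const : ∀ d a → DegreeAtMost d (λ _ → a)
  DegreeAtMost-const zero    a j = -‿inverseʳ a
  DegreeAtMost-const (suc d) a   = DegreeAtMost-const d (a - a)

  DegreeAtMost-+ : ∀ d {f g : ℕ → Carrier} → DegreeAtMost d f → DegreeAtMost d g →
                   DegreeAtMost d (λ j → f j + g j)
  DegreeAtMost-+ zero {f} {g} f≤0 g≤0 j =
    trans (Δ-+ f g j) (trans (+-cong (f≤0 j) (g≤0 j)) (+-identityʳ 0#))
  DegreeAtMost-+ (suc d) {f} {g} f≤d g≤d =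
    DegreeAtMost-cong d (λ j → sym (Δ-+ f g j)) (DegreeAtMost-+ d f≤d g≤d)

  DegreeAtMost-Δⁿ : ∀ d {f : ℕ → Carrier} → DegreeAtMost d f → ∀ j → Δⁿ (suc d) f j ≈ 0#
  DegreeAtMost-Δⁿ zero    f≤0 j = f≤0 j
  DegreeAtMost-Δⁿ (suc d) {f} f≤d j = trans (sym (Δⁿ-Δ (suc d) f j)) (DegreeAtMost-Δⁿ d f≤d j)

  -- Leibniz: Δ (f g) = Δf · (g ∘ suc) + f, and g ∘ suc again has slope one, so induct on the degree.
  DegreeAtMost-*-slope-one : ∀ d {f g : ℕ → Carrier} → DegreeAtMost d f → (∀ j → Δ g j ≈ 1#) →
                             DegreeAtMost (suc d) (λ j → f j * g j)
  DegreeAtMost-*-slope-one d {f} {g} f≤d Δg≈1 =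
    DegreeAtMost-cong d (λ j → sym (Δ[fg]≈ j)) (DegreeAtMost-+ d (degree-Δf*g∘suc d f≤d) f≤d)
    where
    Δ[fg]≈ : ∀ j → Δ (λ i → f i * g i) j ≈ Δ f j * g (suc j) + f j
    Δ[fg]≈ j = trans (Δ-* f g j) (+-congˡ (trans (*-congˡ (Δg≈1 j)) (*-identityʳ (f j))))

    degree-Δf*g∘suc : ∀ e → DegreeAtMost e f → DegreeAtMost e (λ j → Δ f j * g (suc j))
    degree-Δf*g∘suc zero    f≤0 =
      DegreeAtMost-cong zero (λ j → sym (trans (*-congʳ (f≤0 j)) (zeroˡ _))) (DegreeAtMost-const zero 0#)
    degree-Δf*g∘suc (suc e) f≤e = DegreeAtMost-*-slope-one e f≤e (λ j → Δg≈1 (suc j))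

  ∇ⁿ-vanishes : ∀ d {f : ℕ → Carrier} → DegreeAtMost d f → ∀ k → d < k → ∇ⁿ (suc d) f k ≈ 0#
  ∇ⁿ-vanishes d {f} f≤d k d<k = ≡.subst (λ k → ∇ⁿ (suc d) f k ≈ 0#) (ℕ.m∸n+n≡m d<k)
    (trans (∇ⁿ-Δⁿ (suc d) f (k ∸ suc d)) (DegreeAtMost-Δⁿ d f≤d (k ∸ suc d)))

  DegreeAtMost-eulerSeries : ∀ lam n → DegreeAtMost n (eulerSeries R lam n)
  DegreeAtMost-eulerSeries lam zero    = DegreeAtMost-const zero 1#
  DegreeAtMost-eulerSeries lam (suc n) =
    DegreeAtMost-*-slope-one n (DegreeAtMost-eulerSeries lam n) (Δ[ι∘suc-a]≈1 (ι R n * lam))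

  signedBinomial-⋆-eulerSeries : ∀ lam n k → (signedBinomial (suc n) ⋆ eulerSeries R lam n) k ≈ eulerA R lam n k
  signedBinomial-⋆-eulerSeries lam n = ⋆-congˡ (eulerSeries R lam n) (λ i → sym (powS-oneMinusX (suc n) i))

  eulerA-vanishes : ∀ lam {n k} → n < k → eulerA R lam n k ≈ 0#
  eulerA-vanishes lam {n} {k} n<k = trans (powS-oneMinusX-⋆ (suc n) (eulerSeries R lam n) k)
                                          (∇ⁿ-vanishes n (DegreeAtMost-eulerSeries lam n) k n<k)

theorem2p2 : ∀ {c ℓ : Level} (R : CommutativeRing c ℓ) →
    let open CommutativeRing R in
    (lam : Carrier) → ¬ (lam ≈ 0#) → (n k : ℕ) →
    (k ≤ n →
      sumBelow R (suc k) (λ i → ι R (suc n C i) * sgn R i * dfall R lam (ι R (suc (k ∸ i))) n)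
        ≈ eulerA R lam n k)
    × (n < k →
      sumBelow R (suc k) (λ i → ι R (suc n C i) * sgn R i * dfall R lam (ι R (suc (k ∸ i))) n)
        ≈ 0#)
theorem2p2 R lam _ n k =
    (λ _ → signedBinomial-⋆-eulerSeries R lam n k)
  , (λ n<k → CommutativeRing.trans R (signedBinomial-⋆-eulerSeries R lam n k) (eulerA-vanishes R lam n<k))
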